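{- The class of acyclic binary CSP instances equals $\mathrm{CSP}_{TM}(\mathcal{P}(C_3))$.
   Context: A binary CSP instance is a triple $\langle V,D,C\rangle$: $V$ a finite set of variables, a finite domain $D(v)$ for each $v\in V$, and for each ordered pair of distinct variables $(u,v)$ a relation $R_{uv}\subseteq D(u)\times D(v)$, with $R_{vu}=\{(b,a):(a,b)\in R_{uv}\}$. A constraint $R_{uv}$ is trivial if $R_{uv}=D(u)\times D(v)$. The constraint graph of $I$ has vertex set $V$ and an edge $\{u,v\}$ for each non-trivial constraint $R_{uv}$; $I$ is acyclic if its constraint graph is acyclic. A pattern is a structure $\langle X,E^{\sim},E^{+},E^{ - }\rangle$ where $X$ is a set of points, $E^{\sim}$ is an equivalence relation on $X$ whose classes are called parts, and $E^{+}$ (positive edges), $E^{ - }$ (negative edges) are symmetric binary relations on $X$ each disjoint from $E^{\sim}$. For an instance $I$, the pattern $\mathcal{P}(I)$ has points $x_{v,a}$ ($v\in V$, $a\in D(v)$), with $x_{u,a},x_{v,b}$ in the same part iff $u=v$, and for $u\neq v$ the pair $(x_{u,a},x_{v,b})$ is a positive edge if $(a,b)\in R_{uv}$ and a negative edge otherwise. A homomorphism of patterns is a map of points sending same-part pairs to same-part pairs, positive edges to positive edges and negative edges to negative edges; it preserves parts if points in distinct parts are mapped to points in distinct parts. $P_1 \stackrel{SP}{\rightarrow} P_2$ if there is a part-preserving homomorphism $P_1\to P_2$. The subdivision of a pattern at two distinct parts $U,V$ adds a new part containing one new point $z_{xy}$ per positive edge $\{x,y\}$ between $U$ and $V$ and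 two new points $z'_{xy},z''_{xy}$ per negative edge $\{x,y\}$ between $U$ and $V$, removes these edges, and adds positive edges $\{x,z_{xy}\},\{z_{xy},y\}$ respectively negative edges $\{x,z'_{xy}\},\{z''_{xy},y\}$. A subdivision of $P$ is the result of a finite (possibly empty) sequence of such operations. $P_1 \stackrel{TM}{\rightarrow} P_2$ if some subdivision of $P_1$ occurs as a sub-pattern in $P_2$. $\mathrm{CSP}_{TM}(P)$ is the class of binary CSP instances $I$ such that it is not the case that $P \stackrel{TM}{\rightarrow} \mathcal{P}(I)$. For a graph $G=(V,E)$, the negative pattern $\mathcal{P}(G)$ has points $x_{e,v}$ for $e\in E$, $v\in e$; $x_{e,u}$ and $x_{f,v}$ lie in the same part iff $u=v$; there are no positive edges and the negative edges are exactly the pairs $\{x_{e,u},x_{e,v}\}$ with $e=\{u,v\}\in E$. $C_3$ is the cycle on three vertices, so $\mathcal{P}(C_3)$ has three parts of two points each and three negative edges forming a "triangle" through distinct points. -}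

module Defs where

open import Level using (Level; _⊔_) renaming (suc to lsuc; zero to lzero)
open import Data.Nat using (ℕ; zero; suc; _+_)
open import Data.Fin using (Fin; zero; suc; inject₁; fromℕ)
open import Data.Bool using (Bool; true; false)
open import Data.Unit using (⊤)
open import Data.Empty using (⊥)
open import Data.Product using (Σ; Σ-syntax; ∃; ∃-syntax; _×_; _,_; proj₁; proj₂)
open import Data.Sum using (_⊎_; inj₁; inj₂)
open import Relation.Nullary using (¬_)
open import Relation.Binary.PropositionalEquality using (_≡_; _≢_)
open import Function.Definitions using (Injective)

-- Variables are Fin n; the domain of variable v is Fin (D v).
-- R u v a b ≡ true  iff  (a , b) ∈ R_uv.  The value of R on the
-- diagonal (u ≡ v) is never used.  R_vu is the converse of R_uv.

record Instance : Set where
  field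
    n     : ℕ
    D     : Fin n → ℕ
    R     : (u v : Fin n) → Fin (D u) → Fin (D v) → Bool
    R-sym : ∀ u v (a : Fin (D u)) (b : Fin (D v)) → R u v a b ≡ R v u b a

module _ (I : Instance) where
  open Instance I

  Trivial : Fin n → Fin n → Set
  Trivial u v = ∀ (a : Fin (D u)) (b : Fin (D v)) → R u v a b ≡ true

  Adj : Fin n → Fin n → Set
  Adj u v = u ≢ v × ¬ Trivial u v

  Cycle : Set
  Cycle = Σ[ m ∈ ℕ ] Σ[ f ∈ (Fin (3 + m) → Fin n) ]
            Injective _≡_ _≡_ f
          × (∀ (i : Fin (2 + m)) → Adj (f (inject₁ i)) (f (suc i)))
          × Adj (f (fromℕ (2 + m))) (f zero)

  Acyclic : Set
  Acyclic = ¬ Cycle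

record Pattern : Set₁ where
  field
    Pt  : Set
    _∼_ : Pt → Pt → Set       -- E∼ (same part)
    Pos : Pt → Pt → Set
    Neg : Pt → Pt → Set

open Pattern

record SPHom (P₁ P₂ : Pattern) : Set where
  field
    map       : Pt P₁ → Pt P₂
    pres-∼    : ∀ {x y} → _∼_ P₁ x y → _∼_ P₂ (map x) (map y)
    pres-Pos  : ∀ {x y} → Pos P₁ x y → Pos P₂ (map x) (map y)
    pres-Neg  : ∀ {x y} → Neg P₁ x y → Neg P₂ (map x) (map y)
    pres-part : ∀ {x y} → ¬ _∼_ P₁ x y → ¬ _∼_ P₂ (map x) (map y)

_→SP_ : Pattern → Pattern → Set
P₁ →SP P₂ = SPHom P₁ P₂

instancePattern : Instance → Pattern
instancePattern I = record
  { Pt  = Σ[ v ∈ Fin n ] Fin (D v)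
  ; _∼_ = λ x y → proj₁ x ≡ proj₁ y
  ; Pos = λ x y → proj₁ x ≢ proj₁ y × R (proj₁ x) (proj₁ y) (proj₂ x) (proj₂ y) ≡ true
  ; Neg = λ x y → proj₁ x ≢ proj₁ y × R (proj₁ x) (proj₁ y) (proj₂ x) (proj₂ y) ≡ false
  }
  where open Instance I

-- Negative pattern of a graph.  A graph is given by a type of vertices,
-- a type of edges, and the two endpoints of each edge (edge e = {end e 0, end e 1}).

record Graph : Set₁ where
  field
    V   : Set
    E   : Set
    end : E → Bool → V

graphPattern : Graph → Pattern
graphPattern G = record
  { Pt  = E × Bool                       -- x_{e,v}, v = end e i
  ; _∼_ = λ x y → end (proj₁ x) (proj₂ x) ≡ end (proj₁ y) (proj₂ y)
  ; Pos = λ _ _ → ⊥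
  ; Neg = λ x y → proj₁ x ≡ proj₁ y × proj₂ x ≢ proj₂ y
  }
  where open Graph G

C₃ : Graph
C₃ = record { V = Fin 3 ; E = Fin 3 ; end = ends }
  where
  ends : Fin 3 → Bool → Fin 3
  ends e false = e
  ends zero true = suc zero
  ends (suc zero) true = suc (suc zero)
  ends (suc (suc zero)) true = zero

-- Subdivision of P at the two distinct parts U = [u], V = [v].

module Subdivide (P : Pattern) (u v : Pt P) where
  private
    X = Pt P
    _≈_ = _∼_ P

  PosUV : Set
  PosUV = Σ[ x ∈ X ] Σ[ y ∈ X ] (x ≈ u × y ≈ v × Pos P x y)

  NegUV : Set
  NegUV = Σ[ x ∈ X ] Σ[ y ∈ X ] (x ≈ u × y ≈ v × Neg P x y)

  -- new points: z_xy per positive edge; z'_xy (false) and z''_xy (true)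
  -- per negative edge
  New : Set
  New = PosUV ⊎ (Bool × NegUV)

  Pt' : Set
  Pt' = X ⊎ New

  Between : X → X → Set
  Between x y = (x ≈ u × y ≈ v) ⊎ (x ≈ v × y ≈ u)

  Sim : Pt' → Pt' → Set
  Sim (inj₁ x) (inj₁ y) = x ≈ y
  Sim (inj₂ _) (inj₂ _) = ⊤
  Sim _ _ = ⊥

  PosOldNew : X → New → Set
  PosOldNew x (inj₁ (a , b , _)) = x ≡ a ⊎ x ≡ b
  PosOldNew x (inj₂ _) = ⊥

  NegOldNew : X → New → Set
  NegOldNew x (inj₁ _) = ⊥
  NegOldNew x (inj₂ (false , a , b , _)) = x ≡ a
  NegOldNew x (inj₂ (true  , a , b , _)) = x ≡ b

  Pos' : Pt' → Pt' → Set
  Pos' (inj₁ x) (inj₁ y) = Pos P x y × ¬ Between x y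
  Pos' (inj₁ x) (inj₂ z) = PosOldNew x z
  Pos' (inj₂ z) (inj₁ x) = PosOldNew x z
  Pos' (inj₂ _) (inj₂ _) = ⊥

  Neg' : Pt' → Pt' → Set
  Neg' (inj₁ x) (inj₁ y) = Neg P x y × ¬ Between x y
  Neg' (inj₁ x) (inj₂ z) = NegOldNew x z
  Neg' (inj₂ z) (inj₁ x) = NegOldNew x z
  Neg' (inj₂ _) (inj₂ _) = ⊥

  result : Pattern
  result = record { Pt = Pt' ; _∼_ = Sim ; Pos = Pos' ; Neg = Neg' }

subdivide : (P : Pattern) (u v : Pt P) → Pattern
subdivide P u v = Subdivide.result P u v

data IsSubdivision (P : Pattern) : Pattern → Set₁ where
  done : IsSubdivision P P
  step : ∀ {S} (u v : Pt S) → ¬ _∼_ S u v →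
         IsSubdivision P S → IsSubdivision P (subdivide S u v)

_→TM_ : Pattern → Pattern → Set₁
P₁ →TM P₂ = Σ[ S ∈ Pattern ] (IsSubdivision P₁ S × (S →SP P₂))

CSP-TM : Pattern → Instance → Set₁
CSP-TM P I = ¬ (P →TM instancePattern I)

module Submission where

-- (⇒) Call a cycle of 3 + m distinct parts, consecutive ones (cyclically)
-- joined by negative edges, a negative cycle.  𝒫(C₃) is one, and subdividing
-- at two parts U, V keeps a negative cycle: at most one link of the cycle runs
-- between U and V, and the new part is inserted into it; which case occurs is
-- not decidable, so this is proved under a double negation, which suffices as
-- acyclicity is itself a negation.  A part-preserving homomorphism into 𝒫(I)
-- sends a negative cycle to a cycle of the constraint graph of I.
--
-- (⇐) Given a cycle f 0, …, f (2 + m) of I, subdivide m times the edge of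
-- 𝒫(C₃) joining the newest part to part 0.  An invariant (Stage) describes the
-- j-th pattern by a level function on its parts and a map into 𝒫(I) sending
-- each negative edge to a forbidden pair of the corresponding constraint; at
-- j = m this map is a part-preserving homomorphism.

open import Defs
open import Function.Bundles using (_⇔_; mk⇔)
open import Function.Definitions using (Injective)
open import Data.Nat using (ℕ; zero; suc; _+_; _≤_; _<_; z≤n; s≤s; _≟_)
open import Data.Nat.Properties
  using (≤-refl; ≤-trans; <-cmp; n<1+n; n≤1+n; m≤n⇒m≤1+n; m≤n⇒m<n∨m≡n; <⇒≤; <⇒≢; ≤-pred)
open import Data.Fin using (Fin; zero; suc; inject₁; fromℕ; toℕ)
open import Data.Fin.Properties using (toℕ-injective; toℕ-inject₁; toℕ-fromℕ; toℕ<n; ¬∀⟶∃¬; all?)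
open import Data.Bool using (true; false)
open import Data.Bool.Properties using (¬-not) renaming (_≟_ to _≟ᵇ_)
open import Data.Unit using (tt)
open import Data.Empty using (⊥; ⊥-elim)
open import Data.Product using (Σ; Σ-syntax; _×_; _,_; proj₁; proj₂)
open import Data.Sum using (_⊎_; inj₁; inj₂) renaming (map to ⊎-map)
open import Relation.Nullary using (¬_; Dec; yes; no)
open import Relation.Nullary.Negation using (¬¬-map)
open import Relation.Nullary.Decidable using (¬¬-excluded-middle; map′; _×-dec_; _⊎-dec_)
open import Relation.Binary using (tri<; tri≈; tri>)
open import Relation.Binary.PropositionalEquality
  using (_≡_; _≢_; refl; sym; trans; cong; subst; subst₂; module ≡-Reasoning)

open Pattern

record WellFormed (S : Pattern) : Set where
  field
    ∼-sym   : ∀ {x y} → _∼_ S x y → _∼_ S y x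
    ∼-trans : ∀ {x y z} → _∼_ S x y → _∼_ S y z → _∼_ S x z
    Neg-sym : ∀ {x y} → Neg S x y → Neg S y x

module _ {S : Pattern} {u v : Pt S} where
  open Subdivide S u v using (Between)

  between-sym : ∀ {x y} → Between x y → Between y x
  between-sym (inj₁ (x∼u , y∼v)) = inj₂ (y∼v , x∼u)
  between-sym (inj₂ (x∼v , y∼u)) = inj₁ (y∼u , x∼v)

  between-resp : WellFormed S → ∀ {a b x y} → _∼_ S a x → _∼_ S b y → Between a b → Between x y
  between-resp wf a∼x b∼y =
    ⊎-map (λ (a∼u , b∼v) → ∼-trans (∼-sym a∼x) a∼u , ∼-trans (∼-sym b∼y) b∼v)
          (λ (a∼v , b∼u) → ∼-trans (∼-sym a∼x) a∼v , ∼-trans (∼-sym b∼y) b∼u)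
    where open WellFormed wf

subdivide-wellFormed : ∀ {S} (u v : Pt S) → WellFormed S → WellFormed (subdivide S u v)
subdivide-wellFormed {S} u v wf = record
  { ∼-sym   = λ {x} {y} → sym′ {x} {y}
  ; ∼-trans = λ {x} {y} {z} → trans′ {x} {y} {z}
  ; Neg-sym = λ {x} {y} → neg-sym′ {x} {y}
  }
  where
  open WellFormed wf
  S′ : Pattern
  S′ = subdivide S u v
  sym′ : ∀ {x y} → _∼_ S′ x y → _∼_ S′ y x
  sym′ {inj₁ _} {inj₁ _} x∼y = ∼-sym x∼y
  sym′ {inj₂ _} {inj₂ _} _ = tt
  trans′ : ∀ {x y z} → _∼_ S′ x y → _∼_ S′ y z → _∼_ S′ x z
  trans′ {inj₁ _} {inj₁ _} {inj₁ _} x∼y y∼z = ∼-trans x∼y y∼z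
  trans′ {inj₂ _} {inj₂ _} {inj₂ _} _ _ = tt
  neg-sym′ : ∀ {x y} → Neg S′ x y → Neg S′ y x
  neg-sym′ {inj₁ _} {inj₁ _} (neg , ¬between) = Neg-sym neg , λ b → ¬between (between-sym {S} {u} {v} b)
  neg-sym′ {inj₁ _} {inj₂ _} neg = neg
  neg-sym′ {inj₂ _} {inj₁ _} neg = neg

subdivisions-wellFormed : ∀ {P S} → WellFormed P → IsSubdivision P S → WellFormed S
subdivisions-wellFormed wf done = wf
subdivisions-wellFormed wf (step u v _ s) = subdivide-wellFormed u v (subdivisions-wellFormed wf s)

𝒫C₃ : Pattern
𝒫C₃ = graphPattern C₃

𝒫C₃-wellFormed : WellFormed 𝒫C₃
𝒫C₃-wellFormed = record
  { ∼-sym = sym ; ∼-trans = trans ; Neg-sym = λ { (same-edge , ends≢) → sym same-edge , λ e → ends≢ (sym e) } }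

NoPositive : Pattern → Set
NoPositive S = ∀ {x y} → ¬ Pos S x y

subdivide-noPositive : ∀ {S} (u v : Pt S) → NoPositive S → NoPositive (subdivide S u v)
subdivide-noPositive u v no-pos {inj₁ _} {inj₁ _} (pos , _) = no-pos pos
subdivide-noPositive u v no-pos {inj₁ _} {inj₂ (inj₁ (_ , _ , _ , _ , pos))} _ = no-pos pos
subdivide-noPositive u v no-pos {inj₂ (inj₁ (_ , _ , _ , _ , pos))} {inj₁ _} _ = no-pos pos

subdivisions-noPositive : ∀ {P S} → NoPositive P → IsSubdivision P S → NoPositive S
subdivisions-noPositive no-pos done = no-pos
subdivisions-noPositive no-pos (step {S} u v _ s) {x} {y} =
  subdivide-noPositive {S} u v (subdivisions-noPositive no-pos s) {x} {y}

record NegLink (S : Pattern) (x y : Pt S) : Set where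
  constructor link
  field
    src tgt : Pt S
    src∼ : _∼_ S src x
    tgt∼ : _∼_ S tgt y
    neg  : Neg S src tgt

open NegLink

record NegCycle (S : Pattern) : Set where
  field
    m        : ℕ
    part     : ℕ → Pt S
    distinct : ∀ {i j} → i < 3 + m → j < 3 + m → _∼_ S (part i) (part j) → i ≡ j
    closed   : part (3 + m) ≡ part 0
    links    : ∀ {i} → i < 3 + m → NegLink S (part i) (part (suc i))

neg⇒adj : ∀ I {x y : Pt (instancePattern I)} → Neg (instancePattern I) x y → Adj I (proj₁ x) (proj₁ y)
neg⇒adj I {_ , a} {_ , b} (x≢y , forbidden) = x≢y , λ trivial → false≢true (trans (sym forbidden) (trivial a b))
  where
  false≢true : false ≢ true
  false≢true ()

cycle-image : ∀ {I S} → S →SP instancePattern I → NegCycle S → Cycle I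
cycle-image {I} {S} h cyc = m , f , f-injective , path , closing
  where
  open SPHom h
  open NegCycle cyc

  var : Pt S → Fin (Instance.n I)
  var x = proj₁ (map x)

  f : Fin (3 + m) → Fin (Instance.n I)
  f i = var (part (toℕ i))

  f-injective : Injective _≡_ _≡_ f
  f-injective {i} {j} fi≡fj with toℕ i ≟ toℕ j
  ... | yes i≡j = toℕ-injective i≡j
  ... | no i≢j = ⊥-elim (pres-part (λ i∼j → i≢j (distinct (toℕ<n i) (toℕ<n j) i∼j)) fi≡fj)

  link⇒adj : ∀ {x y} → NegLink S x y → Adj I (var x) (var y)
  link⇒adj (link a b a∼x b∼y neg) = subst₂ (Adj I) (pres-∼ a∼x) (pres-∼ b∼y) (neg⇒adj I (pres-Neg neg))

  path : ∀ (i : Fin (2 + m)) → Adj I (f (inject₁ i)) (f (suc i))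
  path i = subst (λ t → Adj I (var (part t)) (f (suc i))) (sym (toℕ-inject₁ i))
                 (link⇒adj (links (m≤n⇒m≤1+n (toℕ<n i))))

  closing : Adj I (f (fromℕ (2 + m))) (f zero)
  closing = subst₂ (λ s t → Adj I (var (part s)) (var t)) (sym (toℕ-fromℕ (2 + m))) closed
                   (link⇒adj (links ≤-refl))

-- Inserting an element w into a sequence c right after position p.  Old
-- position j moves to skip p j; the new element sits at suc p.
skip : ℕ → ℕ → ℕ
skip zero    zero    = zero
skip zero    (suc j) = suc (suc j)
skip (suc p) zero    = zero
skip (suc p) (suc j) = suc (skip p j)

insertAfter : {X : Set} → (ℕ → X) → X → ℕ → ℕ → X
insertAfter c w zero    zero          = c zero
insertAfter c w zero    (suc zero)    = w
insertAfter c w zero    (suc (suc j)) = c (suc j)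
insertAfter c w (suc p) zero          = c zero
insertAfter c w (suc p) (suc i)       = insertAfter (λ j → c (suc j)) w p i

insertAfter-new : ∀ {X : Set} (c : ℕ → X) w p → insertAfter c w p (suc p) ≡ w
insertAfter-new c w zero    = refl
insertAfter-new c w (suc p) = insertAfter-new (λ j → c (suc j)) w p

insertAfter-old : ∀ {X : Set} (c : ℕ → X) w p j → insertAfter c w p (skip p j) ≡ c j
insertAfter-old c w zero    zero    = refl
insertAfter-old c w zero    (suc j) = refl
insertAfter-old c w (suc p) zero    = refl
insertAfter-old c w (suc p) (suc j) = insertAfter-old (λ i → c (suc i)) w p j

data Position (p : ℕ) : ℕ → Set where
  new : Position p (suc p)
  old : ∀ j → Position p (skip p j)

position : ∀ p i → Position p i
position zero    zero          = old zero
position zero    (suc zero)    = new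
position zero    (suc (suc j)) = old (suc j)
position (suc p) zero          = old zero
position (suc p) (suc i) with position p i
... | new   = new
... | old j = old (suc j)

skip-below : ∀ {p j} → j ≤ p → skip p j ≡ j
skip-below {zero}  {zero}  _         = refl
skip-below {suc p} {zero}  _         = refl
skip-below {suc p} {suc j} (s≤s j≤p) = cong suc (skip-below j≤p)

skip-above : ∀ {p j} → p < j → skip p j ≡ suc j
skip-above {zero}  {suc j} _         = refl
skip-above {suc p} {suc j} (s≤s p<j) = cong suc (skip-above p<j)

skip-suc : ∀ {p j} → j ≢ p → suc (skip p j) ≡ skip p (suc j)
skip-suc {p} {j} j≢p with <-cmp j p
... | tri< j<p _ _  = trans (cong suc (skip-below (<⇒≤ j<p))) (sym (skip-below j<p))
... | tri≈ _ j≡p _  = ⊥-elim (j≢p j≡p)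
... | tri> _ _ p<j  = trans (cong suc (skip-above p<j)) (sym (skip-above (m≤n⇒m≤1+n p<j)))

skip-< : ∀ {p j k} → p < k → skip p j < suc k → j < k
skip-< {zero}  {zero}  p<k       _                = p<k
skip-< {zero}  {suc j} _         (s≤s j+2≤k)      = j+2≤k
skip-< {suc p} {zero}  p<k       _                = ≤-trans (s≤s z≤n) p<k
skip-< {suc p} {suc j} (s≤s p<k) (s≤s skip<k) = s≤s (skip-< p<k skip<k)

lift-link : ∀ {S u v x y} (l : NegLink S x y) → ¬ Subdivide.Between S u v (src l) (tgt l) →
            NegLink (subdivide S u v) (inj₁ x) (inj₁ y)
lift-link (link a b a∼x b∼y neg) ¬between = link (inj₁ a) (inj₁ b) a∼x b∼y (neg , ¬between)

-- A negative edge a b between U and V is replaced by a path a — z₁ ∼ z₂ — b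
-- through the new part.
split-edge : ∀ {S} (u v : Pt S) → WellFormed S → ∀ {a b} → Neg S a b → Subdivide.Between S u v a b →
             Σ[ z₁ ∈ Subdivide.New S u v ] Σ[ z₂ ∈ Subdivide.New S u v ]
               (Neg (subdivide S u v) (inj₁ a) (inj₂ z₁) × Neg (subdivide S u v) (inj₂ z₂) (inj₁ b))
split-edge u v wf {a} {b} neg (inj₁ (a∼u , b∼v)) =
  inj₂ (false , a , b , a∼u , b∼v , neg) , inj₂ (true , a , b , a∼u , b∼v , neg) , refl , refl
split-edge u v wf {a} {b} neg (inj₂ (a∼v , b∼u)) =
  inj₂ (true , b , a , b∼u , a∼v , Neg-sym neg) , inj₂ (false , b , a , b∼u , a∼v , Neg-sym neg) , refl , refl
  where open WellFormed wf

Successor : ℕ → ℕ → ℕ → Set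
Successor k i r = r ≡ suc i ⊎ (suc i ≡ k × r ≡ 0)

no-back-and-forth : ∀ {m p q rp rq} → Successor (3 + m) p rp → Successor (3 + m) q rq → p ≡ rq → q ≡ rp → ⊥
no-back-and-forth (inj₁ refl)        (inj₁ refl)       refl ()
no-back-and-forth (inj₁ refl)        (inj₂ (() , refl)) refl refl
no-back-and-forth (inj₂ (() , refl)) (inj₁ refl)       refl refl
no-back-and-forth (inj₂ (() , refl)) (inj₂ (_ , refl)) refl refl

-- Subdividing a well-formed pattern keeps a cycle: if one of its links runs
-- between U and V (there is at most one) the new part is inserted there,
-- otherwise every link survives.  Which case holds is not decidable, so the
-- conclusion is double negated.
module CycleSubdivision {S : Pattern} (wf : WellFormed S) (u v : Pt S) (cyc : NegCycle S) where
  open WellFormed wf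
  open NegCycle cyc
  open Subdivide S u v using (Between)

  private
    S′ : Pattern
    S′ = subdivide S u v
    k : ℕ
    k = 3 + m

  Crossing : ℕ → Set
  Crossing i = Σ[ i<k ∈ i < k ] Between (src (links i<k)) (tgt (links i<k))

  crossing-parts : ∀ {i} → Crossing i → Between (part i) (part (suc i))
  crossing-parts (i<k , between) = between-resp wf (src∼ (links i<k)) (tgt∼ (links i<k)) between

  successor : ∀ {i} → i < k → Σ[ r ∈ ℕ ] (r < k × part (suc i) ≡ part r × Successor k i r)
  successor {i} i<k with m≤n⇒m<n∨m≡n i<k
  ... | inj₁ i+1<k = suc i , i+1<k , refl , inj₁ refl
  ... | inj₂ i+1≡k = 0 , s≤s z≤n , trans (cong part i+1≡k) closed , inj₂ (i+1≡k , refl)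

  no-reversal : ∀ {p q} → p < k → q < k → _∼_ S (part p) (part (suc q)) → _∼_ S (part q) (part (suc p)) → ⊥
  no-reversal p<k q<k p∼q⁺ q∼p⁺ with successor p<k | successor q<k
  ... | rp , rp<k , p⁺≡rp , p→rp | rq , rq<k , q⁺≡rq , q→rq =
    no-back-and-forth p→rp q→rq (distinct p<k rq<k (subst (_∼_ S (part _)) q⁺≡rq p∼q⁺))
                                (distinct q<k rp<k (subst (_∼_ S (part _)) p⁺≡rp q∼p⁺))

  crossing-unique : ∀ {p q} → Crossing p → Crossing q → p ≡ q
  crossing-unique cp@(p<k , _) cq@(q<k , _) with crossing-parts cp | crossing-parts cq
  ... | inj₁ (p∼u , _)    | inj₁ (q∼u , _)    = distinct p<k q<k (∼-trans p∼u (∼-sym q∼u))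
  ... | inj₂ (p∼v , _)    | inj₂ (q∼v , _)    = distinct p<k q<k (∼-trans p∼v (∼-sym q∼v))
  ... | inj₁ (p∼u , p⁺∼v) | inj₂ (q∼v , q⁺∼u) =
    ⊥-elim (no-reversal p<k q<k (∼-trans p∼u (∼-sym q⁺∼u)) (∼-trans q∼v (∼-sym p⁺∼v)))
  ... | inj₂ (p∼v , p⁺∼u) | inj₁ (q∼u , q⁺∼v) =
    ⊥-elim (no-reversal p<k q<k (∼-trans p∼v (∼-sym q⁺∼v)) (∼-trans q∼u (∼-sym p⁺∼u)))

  lifted : (∀ {i} → ¬ Crossing i) → NegCycle S′
  lifted none = record
    { m = m ; part = λ i → inj₁ (part i) ; distinct = distinct ; closed = cong inj₁ closed
    ; links = λ i<k → lift-link (links i<k) (λ between → none (i<k , between)) }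

  module Inserted {p : ℕ} (crossing : Crossing p) where
    p<k : p < k
    p<k = proj₁ crossing

    split : Σ[ z₁ ∈ Subdivide.New S u v ] Σ[ z₂ ∈ Subdivide.New S u v ]
              (Neg S′ (inj₁ (src (links p<k))) (inj₂ z₁) × Neg S′ (inj₂ z₂) (inj₁ (tgt (links p<k))))
    split = split-edge u v wf (neg (links p<k)) (proj₂ crossing)

    W : Pt S′
    W = inj₂ (proj₁ split)

    into : NegLink S′ (inj₁ (part p)) W
    into = link (inj₁ (src (links p<k))) W (src∼ (links p<k)) tt (proj₁ (proj₂ (proj₂ split)))

    out : NegLink S′ W (inj₁ (part (suc p)))
    out = link (inj₂ (proj₁ (proj₂ split))) (inj₁ (tgt (links p<k))) tt (tgt∼ (links p<k))
               (proj₂ (proj₂ (proj₂ split)))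

    part′ : ℕ → Pt S′
    part′ = insertAfter (λ i → inj₁ (part i)) W p

    new-part : part′ (suc p) ≡ W
    new-part = insertAfter-new _ W p

    old-part : ∀ j → part′ (skip p j) ≡ inj₁ (part j)
    old-part = insertAfter-old _ W p

    distinct′ : ∀ {i j} → i < suc k → j < suc k → _∼_ S′ (part′ i) (part′ j) → i ≡ j
    distinct′ {i} {j} i<k′ j<k′ i∼j with position p i | position p j
    ... | new    | new    = refl
    ... | new    | old j′ = ⊥-elim (subst₂ (_∼_ S′) new-part (old-part j′) i∼j)
    ... | old i′ | new    = ⊥-elim (subst₂ (_∼_ S′) (old-part i′) new-part i∼j)
    ... | old i′ | old j′ =
      cong (skip p) (distinct (skip-< p<k i<k′) (skip-< p<k j<k′)
                              (subst₂ (_∼_ S′) (old-part i′) (old-part j′) i∼j))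

    closed′ : part′ (suc k) ≡ part′ 0
    closed′ = begin
      part′ (suc k)     ≡⟨ cong part′ (sym (skip-above p<k)) ⟩
      part′ (skip p k)  ≡⟨ old-part k ⟩
      inj₁ (part k)     ≡⟨ cong inj₁ closed ⟩
      inj₁ (part 0)     ≡⟨ sym (old-part 0) ⟩
      part′ (skip p 0)  ≡⟨ cong part′ (skip-below z≤n) ⟩
      part′ 0           ∎
      where open ≡-Reasoning

    links′ : ∀ {i} → i < suc k → NegLink S′ (part′ i) (part′ (suc i))
    links′ {i} i<k′ with position p i
    ... | new = subst₂ (NegLink S′) (sym new-part) after-new out
      where
      after-new : inj₁ (part (suc p)) ≡ part′ (suc (suc p))
      after-new = trans (sym (old-part (suc p))) (cong part′ (skip-above (n<1+n p)))
    ... | old j with j ≟ p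
    ...   | yes refl = subst₂ (NegLink S′) (sym (old-part p))
                              (sym (trans (cong (λ t → part′ (suc t)) (skip-below ≤-refl)) new-part)) into
    ...   | no j≢p = subst₂ (NegLink S′) (sym (old-part j))
                            (sym (trans (cong part′ (skip-suc j≢p)) (old-part (suc j))))
                            (lift-link (links j<k) (λ between → j≢p (crossing-unique (j<k , between) crossing)))
      where
      j<k : j < k
      j<k = skip-< p<k i<k′

    cycle : NegCycle S′
    cycle = record { m = suc m ; part = part′ ; distinct = distinct′ ; closed = closed′ ; links = links′ }

  subdivided : ¬ ¬ NegCycle S′
  subdivided = ¬¬-map cases ¬¬-excluded-middle
    where
    cases : Dec (Σ ℕ Crossing) → NegCycle S′
    cases (yes (_ , crossing)) = Inserted.cycle crossing
    cases (no none)            = lifted (λ crossing → none (_ , crossing))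

𝒫C₃-cycle : NegCycle 𝒫C₃
𝒫C₃-cycle = record { m = 0 ; part = corner ; distinct = distinct ; closed = refl ; links = links }
  where
  corner : ℕ → Pt 𝒫C₃
  corner 1 = suc zero , false
  corner 2 = suc (suc zero) , false
  corner _ = zero , false

  vertex : Pt 𝒫C₃ → Fin 3
  vertex x = Graph.end C₃ (proj₁ x) (proj₂ x)

  corner-index : ∀ {i} → i < 3 → toℕ (vertex (corner i)) ≡ i
  corner-index {0} _ = refl
  corner-index {1} _ = refl
  corner-index {2} _ = refl
  corner-index {suc (suc (suc _))} (s≤s (s≤s (s≤s ())))

  distinct : ∀ {i j} → i < 3 → j < 3 → _∼_ 𝒫C₃ (corner i) (corner j) → i ≡ j
  distinct i<3 j<3 i∼j = trans (sym (corner-index i<3)) (trans (cong toℕ i∼j) (corner-index j<3))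

  links : ∀ {i} → i < 3 → NegLink 𝒫C₃ (corner i) (corner (suc i))
  links {0} _ = link (zero , false) (zero , true) refl refl (refl , λ ())
  links {1} _ = link (suc zero , false) (suc zero , true) refl refl (refl , λ ())
  links {2} _ = link (suc (suc zero) , false) (suc (suc zero) , true) refl refl (refl , λ ())
  links {suc (suc (suc _))} (s≤s (s≤s (s≤s ())))

subdivisions-cycle : ∀ {P S} → WellFormed P → NegCycle P → IsSubdivision P S → ¬ ¬ NegCycle S
subdivisions-cycle wf cyc done = λ no-cycle → no-cycle cyc
subdivisions-cycle wf cyc (step u v _ s) no-cycle =
  subdivisions-cycle wf cyc s λ cyc′ →
    CycleSubdivision.subdivided (subdivisions-wellFormed wf s) u v cyc′ no-cycle

acyclic⇒CSP-TM : ∀ I → Acyclic I → CSP-TM 𝒫C₃ I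
acyclic⇒CSP-TM I acyclic (S , s , h) =
  subdivisions-cycle 𝒫C₃-wellFormed 𝒫C₃-cycle s λ cyc → acyclic (cycle-image {I} h cyc)

forbidden-pair : ∀ I {u v} → ¬ Trivial I u v →
                 Σ[ a ∈ Fin (Instance.D I u) ] Σ[ b ∈ Fin (Instance.D I v) ] Instance.R I u v a b ≡ false
forbidden-pair I {u} {v} non-trivial = a , b , ¬-not R≢true
  where
  open Instance I
  some-row : Σ[ a ∈ Fin (D u) ] ¬ (∀ b → R u v a b ≡ true)
  some-row = ¬∀⟶∃¬ _ _ (λ a → all? (λ b → R u v a b ≟ᵇ true)) non-trivial
  a : Fin (D u)
  a = proj₁ some-row
  some-column : Σ[ b ∈ Fin (D v) ] R u v a b ≢ true
  some-column = ¬∀⟶∃¬ _ _ (λ b → R u v a b ≟ᵇ true) (proj₂ some-row)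
  b : Fin (D v)
  b = proj₁ some-column
  R≢true : R u v a b ≢ true
  R≢true = proj₂ some-column

instance-Neg-sym : ∀ I {x y} → Neg (instancePattern I) x y → Neg (instancePattern I) y x
instance-Neg-sym I {u , a} {v , b} (u≢v , forbidden) =
  (λ v≡u → u≢v (sym v≡u)) , trans (sym (Instance.R-sym I u v a b)) forbidden

-- Walking around Fin (suc k): clamp k i = min i k, and next k i is the
-- cyclic successor of clamp k i.
clamp : (k : ℕ) → ℕ → Fin (suc k)
clamp k       zero    = zero
clamp zero    (suc i) = zero
clamp (suc k) (suc i) = suc (clamp k i)

-- one step further, except that a wrap-around to zero stays at zero
bump : ∀ {k} → Fin (suc k) → Fin (suc (suc k))
bump zero    = zero
bump (suc x) = suc (suc x)

next : (k : ℕ) → ℕ → Fin (suc k)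
next zero    i       = zero
next (suc k) zero    = suc zero
next (suc k) (suc i) = bump (next k i)

clamp-step : ∀ k i → (Σ[ t ∈ Fin k ] (clamp k i ≡ inject₁ t × next k i ≡ suc t))
                     ⊎ (clamp k i ≡ fromℕ k × next k i ≡ zero)
clamp-step zero    zero    = inj₂ (refl , refl)
clamp-step zero    (suc i) = inj₂ (refl , refl)
clamp-step (suc k) zero    = inj₁ (zero , refl , refl)
clamp-step (suc k) (suc i) with clamp-step k i
... | inj₁ (t , clamp≡ , next≡) = inj₁ (suc t , cong suc clamp≡ , cong bump next≡)
... | inj₂ (clamp≡ , next≡)     = inj₂ (cong suc clamp≡ , cong bump next≡)

next-below : ∀ {k i} → i < k → next k i ≡ clamp k (suc i)
next-below {suc k}       {zero}  _           = refl
next-below {suc (suc k)} {suc i} (s≤s i<k+1) = cong bump (next-below i<k+1)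

next-last : ∀ k → next k k ≡ zero
next-last zero    = refl
next-last (suc k) = cong bump (next-last k)

toℕ-clamp : ∀ {k i} → i ≤ k → toℕ (clamp k i) ≡ i
toℕ-clamp {k}     {zero}  _         = refl
toℕ-clamp {suc k} {suc i} (s≤s i≤k) = cong suc (toℕ-clamp i≤k)

clamp-injective : ∀ {k i j} → i ≤ k → j ≤ k → clamp k i ≡ clamp k j → i ≡ j
clamp-injective i≤k j≤k eq = trans (sym (toℕ-clamp i≤k)) (trans (cong toℕ eq) (toℕ-clamp j≤k))

-- Unfolding a cycle f 0, …, f (2 + m) of I into a subdivision of 𝒫(C₃):
-- subdividing m times the edge between the last part and part 0 yields a
-- triangle stretched to 3 + m parts, whose part at level i is sent to the
-- variable f i and whose i-th negative edge to a forbidden pair of the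
-- constraint between f i and its successor on the cycle.
module Unfolding (I : Instance) (m : ℕ) (f : Fin (3 + m) → Fin (Instance.n I))
                 (f-injective : Injective _≡_ _≡_ f)
                 (path : ∀ (i : Fin (2 + m)) → Adj I (f (inject₁ i)) (f (suc i)))
                 (closing : Adj I (f (fromℕ (2 + m))) (f zero)) where
  open Instance I

  𝒫I : Pattern
  𝒫I = instancePattern I

  F F⁺ : ℕ → Fin n
  F  i = f (clamp (2 + m) i)
  F⁺ i = f (next (2 + m) i)

  adjacent : ∀ i → Adj I (F i) (F⁺ i)
  adjacent i with clamp-step (2 + m) i
  ... | inj₁ (t , clamp≡ , next≡) = subst₂ (Adj I) (cong f (sym clamp≡)) (cong f (sym next≡)) (path t)
  ... | inj₂ (clamp≡ , next≡)     = subst₂ (Adj I) (cong f (sym clamp≡)) (cong f (sym next≡)) closing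

  F-injective : ∀ {i j} → i ≤ 2 + m → j ≤ 2 + m → F i ≡ F j → i ≡ j
  F-injective i≤ j≤ Fi≡Fj = clamp-injective i≤ j≤ (f-injective Fi≡Fj)

  F⁺-below : ∀ {i} → i < 2 + m → F⁺ i ≡ F (suc i)
  F⁺-below i< = cong f (next-below i<)

  F⁺-last : F⁺ (2 + m) ≡ F 0
  F⁺-last = cong f (next-last (2 + m))

  forbidden : ∀ i → Σ[ a ∈ Fin (D (F i)) ] Σ[ b ∈ Fin (D (F⁺ i)) ] R (F i) (F⁺ i) a b ≡ false
  forbidden i = forbidden-pair I (proj₂ (adjacent i))

  pa pb : ℕ → Pt 𝒫I
  pa i = F i , proj₁ (forbidden i)
  pb i = F⁺ i , proj₁ (proj₂ (forbidden i))

  pa-pb : ∀ i → Neg 𝒫I (pa i) (pb i)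
  pa-pb i = proj₁ (adjacent i) , proj₂ (proj₂ (forbidden i))

  -- After j subdivisions: a subdivision S of 𝒫(C₃) whose parts are the levels
  -- 0, …, 2 + j, with a map g into 𝒫(I) respecting levels and negative edges,
  -- except the pending edges between U (level 2 + j) and V (level 0), which are
  -- sent to (pa (2 + j) , pb (2 + m)); this is a negative edge once j = m.
  record Stage (j : ℕ) : Set₁ where
    field
      S           : Pattern
      subdivision : IsSubdivision 𝒫C₃ S
      u v         : Pt S
      level       : Pt S → ℕ
      level-∼     : ∀ {x y} → _∼_ S x y → level x ≡ level y
      ∼-level     : ∀ {x y} → level x ≡ level y → _∼_ S x y
      level-≤     : ∀ x → level x ≤ 2 + j
      level-u     : level u ≡ 2 + j
      level-v     : level v ≡ 0
      g           : Pt S → Pt 𝒫I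
      g-var       : ∀ x → proj₁ (g x) ≡ F (level x)
      g-neg       : ∀ {x y} → Neg S x y → ¬ Subdivide.Between S u v x y → Neg 𝒫I (g x) (g y)
      g-pending   : ∀ {x y} → _∼_ S x u → _∼_ S y v → Neg S x y → g x ≡ pa (2 + j) × g y ≡ pb (2 + m)
      -- a pending edge exists, so the next subdivision has a non-empty new part
      pending     : Subdivide.NegUV S u v

    no-positive : NoPositive S
    no-positive = subdivisions-noPositive (λ ()) subdivision

    u≁v : ¬ _∼_ S u v
    u≁v u∼v with trans (sym level-u) (trans (level-∼ u∼v) level-v)
    ... | ()

  stage₀ : Stage 0
  stage₀ = record
    { S = 𝒫C₃ ; subdivision = done ; u = u₀ ; v = v₀ ; level = level₀
    ; level-∼ = cong toℕ ; ∼-level = toℕ-injective ; level-≤ = level₀-≤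
    ; level-u = refl ; level-v = refl ; g = g₀ ; g-var = g₀-var
    ; g-neg = g₀-neg ; g-pending = g₀-pending
    ; pending = u₀ , v₀ , refl , refl , refl , (λ ()) }
    where
    edge₂ : Fin 3
    edge₂ = suc (suc zero)

    u₀ v₀ : Pt 𝒫C₃
    u₀ = edge₂ , false
    v₀ = edge₂ , true

    level₀ : Pt 𝒫C₃ → ℕ
    level₀ (e , b) = toℕ (Graph.end C₃ e b)

    level₀-≤ : ∀ x → level₀ x ≤ 2
    level₀-≤ x = ≤-pred (toℕ<n (Graph.end C₃ (proj₁ x) (proj₂ x)))

    g₀ : Pt 𝒫C₃ → Pt 𝒫I
    g₀ (zero , false)             = pa 0
    g₀ (zero , true)              = pb 0
    g₀ (suc zero , false)         = pa 1
    g₀ (suc zero , true)          = pb 1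
    g₀ (suc (suc zero) , false)   = pa 2
    g₀ (suc (suc zero) , true)    = pb (2 + m)

    g₀-var : ∀ x → proj₁ (g₀ x) ≡ F (level₀ x)
    g₀-var (zero , false)           = refl
    g₀-var (zero , true)            = F⁺-below (s≤s z≤n)
    g₀-var (suc zero , false)       = refl
    g₀-var (suc zero , true)        = F⁺-below (s≤s (s≤s z≤n))
    g₀-var (suc (suc zero) , false) = refl
    g₀-var (suc (suc zero) , true)  = F⁺-last

    g₀-neg : ∀ {x y} → Neg 𝒫C₃ x y → ¬ Subdivide.Between 𝒫C₃ u₀ v₀ x y → Neg 𝒫I (g₀ x) (g₀ y)
    g₀-neg {zero , false}           {zero , true}           _ _ = pa-pb 0
    g₀-neg {zero , true}            {zero , false}          _ _ = instance-Neg-sym I (pa-pb 0)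
    g₀-neg {suc zero , false}       {suc zero , true}       _ _ = pa-pb 1
    g₀-neg {suc zero , true}        {suc zero , false}      _ _ = instance-Neg-sym I (pa-pb 1)
    g₀-neg {suc (suc zero) , false} {suc (suc zero) , true}  _ ¬between = ⊥-elim (¬between (inj₁ (refl , refl)))
    g₀-neg {suc (suc zero) , true}  {suc (suc zero) , false} _ ¬between = ⊥-elim (¬between (inj₂ (refl , refl)))
    g₀-neg {_ , false} {_ , false} (_ , ends≢) _ = ⊥-elim (ends≢ refl)
    g₀-neg {_ , true}  {_ , true}  (_ , ends≢) _ = ⊥-elim (ends≢ refl)

    g₀-pending : ∀ {x y} → _∼_ 𝒫C₃ x u₀ → _∼_ 𝒫C₃ y v₀ → Neg 𝒫C₃ x y → g₀ x ≡ pa 2 × g₀ y ≡ pb (2 + m)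
    g₀-pending {suc (suc zero) , false} {suc (suc zero) , true}  _ _ _ = refl , refl
    g₀-pending {suc (suc zero) , false} {suc (suc zero) , false} _ _ (_ , ends≢) = ⊥-elim (ends≢ refl)
    g₀-pending {suc zero , true}        {suc zero , true}        _ _ (_ , ends≢) = ⊥-elim (ends≢ refl)
    g₀-pending {suc zero , true}        {suc zero , false}       _ () _
    g₀-pending {zero , false}           () _ _
    g₀-pending {zero , true}            () _ _
    g₀-pending {suc zero , false}       () _ _
    g₀-pending {suc (suc zero) , true}  () _ _

  -- The new part W gets level
  -- 3 + j; an edge a — b between U and V becomes a — z′ (sent to the genuine
  -- edge pa (2 + j) — pb (2 + j)) and z″ — b, the new pending edge from W to V.
  module NextStage {j : ℕ} (j<m : j < m) (st : Stage j) where
    open Stage st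

    S′ : Pattern
    S′ = subdivide S u v

    u′ v′ : Pt S′
    u′ = inj₂ (inj₂ (true , pending))
    v′ = inj₁ v

    level′ : Pt S′ → ℕ
    level′ (inj₁ x) = level x
    level′ (inj₂ _) = 3 + j

    old-level≢ : ∀ x → level x ≢ 3 + j
    old-level≢ x = <⇒≢ (s≤s (level-≤ x))

    level′-∼ : ∀ {x y} → _∼_ S′ x y → level′ x ≡ level′ y
    level′-∼ {inj₁ _} {inj₁ _} x∼y = level-∼ x∼y
    level′-∼ {inj₂ _} {inj₂ _} _   = refl

    ∼-level′ : ∀ {x y} → level′ x ≡ level′ y → _∼_ S′ x y
    ∼-level′ {inj₁ _} {inj₁ _} eq = ∼-level eq
    ∼-level′ {inj₁ x} {inj₂ _} eq = ⊥-elim (old-level≢ x eq)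
    ∼-level′ {inj₂ _} {inj₁ y} eq = ⊥-elim (old-level≢ y (sym eq))
    ∼-level′ {inj₂ _} {inj₂ _} _  = tt

    level′-≤ : ∀ x → level′ x ≤ 3 + j
    level′-≤ (inj₁ x) = m≤n⇒m≤1+n (level-≤ x)
    level′-≤ (inj₂ _) = ≤-refl

    g′ : Pt S′ → Pt 𝒫I
    g′ (inj₁ x)                            = g x
    g′ (inj₂ (inj₁ (_ , _ , _ , _ , pos))) = ⊥-elim (no-positive pos)
    g′ (inj₂ (inj₂ (false , _)))           = pb (2 + j)
    g′ (inj₂ (inj₂ (true , _)))            = pa (3 + j)

    g′-var : ∀ x → proj₁ (g′ x) ≡ F (level′ x)
    g′-var (inj₁ x)                            = g-var x
    g′-var (inj₂ (inj₁ (_ , _ , _ , _ , pos))) = ⊥-elim (no-positive pos)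
    g′-var (inj₂ (inj₂ (false , _)))           = F⁺-below (s≤s (s≤s j<m))
    g′-var (inj₂ (inj₂ (true , _)))            = refl

    g′-neg : ∀ {x y} → Neg S′ x y → ¬ Subdivide.Between S′ u′ v′ x y → Neg 𝒫I (g′ x) (g′ y)
    g′-neg {inj₁ _} {inj₁ _} (neg , ¬between) _ = g-neg neg ¬between
    g′-neg {inj₁ _} {inj₂ (inj₂ (false , a , b , a∼u , b∼v , neg))} refl _ =
      subst (λ x → Neg 𝒫I x (pb (2 + j))) (sym (proj₁ (g-pending a∼u b∼v neg))) (pa-pb (2 + j))
    g′-neg {inj₂ (inj₂ (false , a , b , a∼u , b∼v , neg))} {inj₁ _} refl _ =
      subst (Neg 𝒫I (pb (2 + j))) (sym (proj₁ (g-pending a∼u b∼v neg))) (instance-Neg-sym I (pa-pb (2 + j)))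
    g′-neg {inj₁ _} {inj₂ (inj₂ (true , _ , _ , _ , b∼v , _))} refl ¬between = ⊥-elim (¬between (inj₂ (b∼v , tt)))
    g′-neg {inj₂ (inj₂ (true , _ , _ , _ , b∼v , _))} {inj₁ _} refl ¬between = ⊥-elim (¬between (inj₁ (tt , b∼v)))

    g′-pending : ∀ {x y} → _∼_ S′ x u′ → _∼_ S′ y v′ → Neg S′ x y → g′ x ≡ pa (3 + j) × g′ y ≡ pb (2 + m)
    g′-pending {inj₂ (inj₂ (false , a , _ , a∼u , _ , _))} {inj₁ _} _ a∼v refl =
      ⊥-elim (u≁v (∼-level (trans (sym (level-∼ a∼u)) (level-∼ a∼v))))
    g′-pending {inj₂ (inj₂ (true , _ , _ , a∼u , b∼v , neg))} {inj₁ _} _ _ refl =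
      refl , proj₂ (g-pending a∼u b∼v neg)

    stage′ : Stage (suc j)
    stage′ = record
      { S = S′ ; subdivision = step u v u≁v subdivision ; u = u′ ; v = v′ ; level = level′
      ; level-∼ = λ {x} {y} → level′-∼ {x} {y} ; ∼-level = λ {x} {y} → ∼-level′ {x} {y} ; level-≤ = level′-≤
      ; level-u = refl ; level-v = level-v ; g = g′ ; g-var = g′-var
      ; g-neg = λ {x} {y} → g′-neg {x} {y} ; g-pending = λ {x} {y} → g′-pending {x} {y}
      ; pending = u′ , inj₁ (proj₁ (proj₂ pending)) , tt , proj₁ (proj₂ (proj₂ (proj₂ pending))) , refl }

  stages : ∀ j → j ≤ m → Stage j
  stages zero    _     = stage₀
  stages (suc j) j+1≤m = NextStage.stage′ j+1≤m (stages j (≤-trans (n≤1+n j) j+1≤m))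

  -- At stage m the pending edges are sent to the genuine edge pa (2 + m) —
  -- pb (2 + m), so g is a part-preserving homomorphism.
  module LastStage (st : Stage m) where
    open Stage st
    open WellFormed (subdivisions-wellFormed 𝒫C₃-wellFormed subdivision)

    same-part? : ∀ x y → Dec (_∼_ S x y)
    same-part? x y = map′ ∼-level level-∼ (level x ≟ level y)

    g-Neg : ∀ {x y} → Neg S x y → Neg 𝒫I (g x) (g y)
    g-Neg {x} {y} neg with (same-part? x u ×-dec same-part? y v) ⊎-dec (same-part? x v ×-dec same-part? y u)
    ... | yes (inj₁ (x∼u , y∼v)) with g-pending x∼u y∼v neg
    ...   | gx≡ , gy≡ = subst₂ (Neg 𝒫I) (sym gx≡) (sym gy≡) (pa-pb (2 + m))
    g-Neg {x} {y} neg | yes (inj₂ (x∼v , y∼u)) with g-pending y∼u x∼v (Neg-sym neg)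
    ...   | gy≡ , gx≡ = subst₂ (Neg 𝒫I) (sym gx≡) (sym gy≡) (instance-Neg-sym I (pa-pb (2 + m)))
    g-Neg {x} {y} neg | no ¬between = g-neg neg ¬between

    homomorphism : S →SP 𝒫I
    homomorphism = record
      { map       = g
      ; pres-∼    = λ {x} {y} x∼y → trans (g-var x) (trans (cong F (level-∼ x∼y)) (sym (g-var y)))
      ; pres-Pos  = λ pos → ⊥-elim (no-positive pos)
      ; pres-Neg  = g-Neg
      ; pres-part = λ {x} {y} x≁y gx∼gy → x≁y (∼-level (F-injective (level-≤ x) (level-≤ y)
                                              (trans (sym (g-var x)) (trans gx∼gy (g-var y)))))
      }

  unfolded : 𝒫C₃ →TM 𝒫I
  unfolded = S , subdivision , LastStage.homomorphism last
    where
    last : Stage m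
    last = stages m ≤-refl
    open Stage last using (S; subdivision)

CSP-TM⇒acyclic : ∀ I → CSP-TM 𝒫C₃ I → Acyclic I
CSP-TM⇒acyclic I free (m , f , f-injective , path , closing) = free (Unfolding.unfolded I m f f-injective path closing)

proposition4p3 : (I : Instance) → Acyclic I ⇔ CSP-TM (graphPattern C₃) I
proposition4p3 I = mk⇔ (acyclic⇒CSP-TM I) (CSP-TM⇒acyclic I)
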